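{- Let $S$ be an RNA sequence of length $n$ and $i,j,t,o$ integers with $2\le i\le t\le o<j\le n$. Then $P[i,j,t,o]\le P[i-1,j,t,o]\le P[i,j,t,o]+1$, where $P[a,j,t,o]=\max_{t\le l\le o}\{M[a,l]+M[l+1,j]\}$.
   Context: An RNA sequence is a string $S[1\cdots n]$ over $\{A,C,G,U\}$. Nucleotides are complementary if they are $\{A,U\}$ or $\{G,C\}$. A base pair is a pair of positions $(p,q)$, $p<q$, with $S[p],S[q]$ complementary. A set of base pairs is non-crossing if each position occurs in at most one pair and there are no two pairs $(a,b),(c,d)$ with $a<c<b<d$. For $1\le a\le b\le n$, $M[a,b]$ is the maximum number of base pairs in a non-crossing set of base pairs with all positions in $\{a,\dots,b\}$. -}

module Defs where

open import Data.Nat using (ℕ; zero; suc; _+_; _≤_; _<_)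
open import Data.Product using (Σ; _×_; _,_; ∃)
open import Data.List using (List; []; _∷_; length; concatMap)
open import Data.List.Relation.Unary.All using (All)
open import Data.List.Relation.Unary.Unique.Propositional using (Unique)
open import Data.List.Membership.Propositional using (_∈_)
open import Data.Maybe using (Maybe; just; nothing)
open import Data.Vec using (Vec; []; _∷_)
open import Relation.Nullary using (¬_)
open import Relation.Binary.PropositionalEquality using (_≡_)

data Base : Set where
  A C G U : Base

data Complementary : Base → Base → Set where
  AU : Complementary A U
  UA : Complementary U A
  GC : Complementary G C
  CG : Complementary C G

-- 1-indexed access: S[p] for 1 ≤ p ≤ n, nothing otherwise
baseAt : ∀ {n} → Vec Base n → ℕ → Maybe Base
baseAt []      _             = nothing
baseAt (x ∷ s) zero          = nothing
baseAt (x ∷ s) (suc zero)    = just x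
baseAt (x ∷ s) (suc (suc p)) = baseAt s (suc p)

data ComplAt : Maybe Base → Maybe Base → Set where
  compl : ∀ {x y} → Complementary x y → ComplAt (just x) (just y)

BasePairIn : ∀ {n} → Vec Base n → ℕ → ℕ → ℕ × ℕ → Set
BasePairIn S a b (p , q) = a ≤ p × p < q × q ≤ b × ComplAt (baseAt S p) (baseAt S q)

positions : List (ℕ × ℕ) → List ℕ
positions = concatMap (λ { (p , q) → p ∷ q ∷ [] })

NonCrossing : List (ℕ × ℕ) → Set
NonCrossing ps = ∀ {a b c d} → (a , b) ∈ ps → (c , d) ∈ ps →
  ¬ (a < c × c < b × b < d)

-- a non-crossing set of base pairs with all positions in {a,…,b}
-- (each position occurs in at most one pair: positions are unique)
ValidIn : ∀ {n} → Vec Base n → ℕ → ℕ → List (ℕ × ℕ) → Set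
ValidIn S a b ps = All (BasePairIn S a b) ps × Unique (positions ps) × NonCrossing ps

-- IsM S a b m  :⇔  m = M[a,b]  (maximum size of such a set)
IsM : ∀ {n} → Vec Base n → ℕ → ℕ → ℕ → Set
IsM S a b m =
  (Σ (List (ℕ × ℕ)) λ ps → ValidIn S a b ps × length ps ≡ m)
  × (∀ ps → ValidIn S a b ps → length ps ≤ m)

-- IsP S a j t o x  :⇔  x = P[a,j,t,o] = max_{t ≤ l ≤ o} (M[a,l] + M[l+1,j])
IsP : ∀ {n} → Vec Base n → ℕ → ℕ → ℕ → ℕ → ℕ → Set
IsP S a j t o x =
  (∃ λ l → t ≤ l × l ≤ o × Σ ℕ λ m₁ → Σ ℕ λ m₂ →
     IsM S a l m₁ × IsM S (suc l) j m₂ × m₁ + m₂ ≡ x)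
  × (∀ l m₁ m₂ → t ≤ l → l ≤ o → IsM S a l m₁ → IsM S (suc l) j m₂ → m₁ + m₂ ≤ x)

-- M and P are only characterised relationally (IsM, IsP), so we first show that the
-- maxima exist and then compare them.
--   1. Validity of a set of base pairs is decidable.
--   2. Dropping the (unique) pair that starts at a turns a set valid in [a,b] into one
--      valid in [a+1,b] and loses at most one pair.  Hence M[a+1,b] ≤ M[a,b] ≤ M[a+1,b]+1,
--      and, iterating, a valid set in [a,b] has at most b + 1 - a pairs.
--   3. Valid sets of a given size range over a finite list of candidates, so by 1 and
--      the bound of 2 a search for the largest achievable size yields M[a,b].
--   4. A function on a non-empty range [t,o] has a maximiser (the library argmax), and
--      the maxima of two functions with f ≤ g ≤ f + 1 satisfy the same inequalities.
--   5. P[a,j,t,o] is the maximum over l ∈ [t,o] of M[a,l] + M[l+1,j]; by 2 these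
--      values for a = i and a = i - 1 are sandwiched, and 4 concludes.
module Submission where

open import Defs
open import Data.Nat using (ℕ; zero; suc; _+_; _∸_; _≤_; _<_; z≤n; s≤s; _≟_; _≤?_; _<?_)
open import Data.Nat.Properties
open import Data.Product using (Σ; _×_; _,_; proj₁; proj₂; ∃)
open import Data.Vec using (Vec)
open import Data.List using (List; []; _∷_; length; filter; upTo; cartesianProduct; cartesianProductWith)
open import Data.List.Properties using (filter-all; filter-accept; filter-reject)
open import Data.List.Relation.Unary.All as All using (All; []; _∷_)
open import Data.List.Relation.Unary.All.Properties using (all-filter) renaming (filter⁺ to All-filter⁺)
open import Data.List.Relation.Unary.Any as Any using (here)
open import Data.List.Relation.Unary.AllPairs using ([]; _∷_)
open import Data.List.Relation.Unary.Unique.Propositional using (Unique)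
open import Data.List.Relation.Unary.Unique.DecPropositional _≟_ using (unique?)
open import Data.List.Membership.Propositional using (_∈_; lose)
open import Data.List.Membership.Propositional.Properties
  using (∈-cartesianProduct⁺; ∈-cartesianProductWith⁺; ∈-upTo⁺; ∈-upTo⁻; ∈-filter⁺; ∈-filter⁻)
open import Data.List.Extrema.Nat using (argmax; argmax-all; f[xs]≤f[argmax])
open import Data.Maybe using (Maybe; just; nothing)
open import Relation.Nullary using (¬_; Dec; yes; no; ¬?; contradiction)
open import Relation.Nullary.Decidable using (_×-dec_; map′)
open import Relation.Unary using (Decidable)
open import Relation.Binary.PropositionalEquality using (_≡_; _≢_; refl; sym; cong; cong₂; subst; ≢-sym; module ≡-Reasoning)
open import Function using (_∘′_)

complementary? : (x y : Base) → Dec (Complementary x y)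
complementary? A U = yes AU
complementary? U A = yes UA
complementary? G C = yes GC
complementary? C G = yes CG
complementary? A A = no λ ()
complementary? A C = no λ ()
complementary? A G = no λ ()
complementary? C A = no λ ()
complementary? C C = no λ ()
complementary? C U = no λ ()
complementary? G A = no λ ()
complementary? G G = no λ ()
complementary? G U = no λ ()
complementary? U C = no λ ()
complementary? U G = no λ ()
complementary? U U = no λ ()

complAt? : (x y : Maybe Base) → Dec (ComplAt x y)
complAt? (just x) (just y) with complementary? x y
... | yes c = yes (compl c)
... | no ¬c = no λ { (compl c) → ¬c c }
complAt? (just x) nothing = no λ ()
complAt? nothing y = no λ ()

basePairIn? : ∀ {n} (S : Vec Base n) a b → Decidable (BasePairIn S a b)
basePairIn? S a b (p , q) =
  (a ≤? p) ×-dec (p <? q) ×-dec (q ≤? b) ×-dec complAt? (baseAt S p) (baseAt S q)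

Crossing : ℕ × ℕ → ℕ × ℕ → Set
Crossing (a , b) (c , d) = a < c × c < b × b < d

crossing? : ∀ x y → Dec (Crossing x y)
crossing? (a , b) (c , d) = (a <? c) ×-dec (c <? b) ×-dec (b <? d)

-- NonCrossing quantifies over memberships; this list-indexed form is decidable.
NoCrossingPair : List (ℕ × ℕ) → Set
NoCrossingPair ps = All (λ x → All (λ y → ¬ Crossing x y) ps) ps

nonCrossing? : ∀ ps → Dec (NonCrossing ps)
nonCrossing? ps = map′ toNonCrossing fromNonCrossing
  (All.all? (λ x → All.all? (λ y → ¬? (crossing? x y)) ps) ps)
  where
  toNonCrossing : NoCrossingPair ps → NonCrossing ps
  toNonCrossing h x∈ y∈ = All.lookup (All.lookup h x∈) y∈

  fromNonCrossing : NonCrossing ps → NoCrossingPair ps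
  fromNonCrossing nc = All.tabulate λ { {a , b} x∈ → All.tabulate λ { {c , d} y∈ → nc x∈ y∈ } }

valid? : ∀ {n} (S : Vec Base n) a b → Decidable (ValidIn S a b)
valid? S a b ps = All.all? (basePairIn? S a b) ps ×-dec unique? (positions ps) ×-dec nonCrossing? ps

All-positions⁻ : ∀ {P : ℕ → Set} {ps} → All P (positions ps) → All (λ x → P (proj₁ x) × P (proj₂ x)) ps
All-positions⁻ {ps = []} [] = []
All-positions⁻ {ps = (p , q) ∷ ps} (Pp ∷ Pq ∷ h) = (Pp , Pq) ∷ All-positions⁻ h

All-positions⁺ : ∀ {P : ℕ → Set} {ps} → All (λ x → P (proj₁ x) × P (proj₂ x)) ps → All P (positions ps)
All-positions⁺ [] = []
All-positions⁺ ((Pp , Pq) ∷ h) = Pp ∷ Pq ∷ All-positions⁺ h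

All-positions-filter : ∀ {P : ℕ → Set} {Q : ℕ × ℕ → Set} (Q? : Decidable Q) ps →
  All P (positions ps) → All P (positions (filter Q? ps))
All-positions-filter Q? ps h = All-positions⁺ (All-filter⁺ Q? (All-positions⁻ {ps = ps} h))

unique-positions-filter : ∀ {Q : ℕ × ℕ → Set} (Q? : Decidable Q) ps →
  Unique (positions ps) → Unique (positions (filter Q? ps))
unique-positions-filter Q? [] u = u
unique-positions-filter {Q} Q? ((p , q) ∷ ps) ((p≢q ∷ p∉ps) ∷ q∉ps ∷ u) = byHead (Q? (p , q))
  where
  byHead : Dec (Q (p , q)) → Unique (positions (filter Q? ((p , q) ∷ ps)))
  byHead (yes Qx) = subst (Unique ∘′ positions) (sym (filter-accept Q? Qx))
    ((p≢q ∷ All-positions-filter Q? ps p∉ps) ∷ All-positions-filter Q? ps q∉ps ∷ unique-positions-filter Q? ps u)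
  byHead (no ¬Qx) = subst (Unique ∘′ positions) (sym (filter-reject Q? ¬Qx)) (unique-positions-filter Q? ps u)

notStartingAt? : ∀ a → Decidable (λ (x : ℕ × ℕ) → proj₁ x ≢ a)
notStartingAt? a x = ¬? (proj₁ x ≟ a)

dropStart : ℕ → List (ℕ × ℕ) → List (ℕ × ℕ)
dropStart a = filter (notStartingAt? a)

dropStart-valid : ∀ {n} (S : Vec Base n) a b ps → ValidIn S a b ps → ValidIn S (suc a) b (dropStart a ps)
dropStart-valid S a b ps (pairs , u , nc) =
  All.map shift (All.zip (all-filter (notStartingAt? a) ps , All-filter⁺ _ pairs)) ,
  unique-positions-filter _ ps u ,
  λ x∈ y∈ → nc (proj₁ (∈-filter⁻ _ x∈)) (proj₁ (∈-filter⁻ _ y∈))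
  where
  shift : ∀ {x} → proj₁ x ≢ a × BasePairIn S a b x → BasePairIn S (suc a) b x
  shift (p≢a , a≤p , rest) = ≤∧≢⇒< a≤p (≢-sym p≢a) , rest

-- Since positions are distinct, at most one pair starts at a.
length-dropStart : ∀ a ps → Unique (positions ps) → length ps ≤ suc (length (dropStart a ps))
length-dropStart a [] u = z≤n
length-dropStart a ((p , q) ∷ ps) ((_ ∷ p∉ps) ∷ _ ∷ u) = byHead (p ≟ a)
  where
  byHead : Dec (p ≡ a) → length ((p , q) ∷ ps) ≤ suc (length (dropStart a ((p , q) ∷ ps)))
  byHead (yes refl) = ≤-reflexive (cong (suc ∘′ length) (sym (begin
    dropStart p ((p , q) ∷ ps) ≡⟨ filter-reject (notStartingAt? p) (λ p≢p → p≢p refl) ⟩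
    dropStart p ps             ≡⟨ filter-all (notStartingAt? p) (All.map (≢-sym ∘′ proj₁) (All-positions⁻ p∉ps)) ⟩
    ps                         ∎)))
    where open ≡-Reasoning
  byHead (no p≢a) = subst (λ r → suc (length ps) ≤ suc (length r))
    (sym (filter-accept (notStartingAt? a) p≢a)) (s≤s (length-dropStart a ps u))

valid-weaken : ∀ {n} (S : Vec Base n) a b ps → ValidIn S (suc a) b ps → ValidIn S a b ps
valid-weaken S a b ps (pairs , u , nc) = All.map (λ (a<p , rest) → <⇒≤ a<p , rest) pairs , u , nc

IsM-step : ∀ {n} (S : Vec Base n) a b {m₁ m₀} → IsM S (suc a) b m₁ → IsM S a b m₀ → m₁ ≤ m₀ × m₀ ≤ suc m₁
IsM-step S a b ((ps₁ , v₁ , refl) , max₁) ((ps₀ , v₀ , refl) , max₀) =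
  max₀ ps₁ (valid-weaken S a b ps₁ v₁) ,
  ≤-trans (length-dropStart a ps₀ (proj₁ (proj₂ v₀))) (s≤s (max₁ (dropStart a ps₀) (dropStart-valid S a b ps₀ v₀)))

-- Iterating the removal: a valid set in [a,b] has at most k pairs whenever b < k + a.
length-valid : ∀ {n} (S : Vec Base n) k a b ps → b < k + a → ValidIn S a b ps → length ps ≤ k
length-valid S zero a b [] _ _ = z≤n
length-valid S zero a b (_ ∷ _) b<a ((a≤p , p<q , q≤b , _) ∷ _ , _) =
  contradiction (≤-trans a≤p (≤-trans (<⇒≤ p<q) q≤b)) (<⇒≱ b<a)
length-valid S (suc k) a b ps b<1+k+a v@(_ , u , _) =
  ≤-trans (length-dropStart a ps u)
    (s≤s (length-valid S k (suc a) b (dropStart a ps) (subst (b <_) (sym (+-suc k a)) b<1+k+a)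
      (dropStart-valid S a b ps v)))

listsOver : ∀ {A : Set} → ℕ → List A → List (List A)
listsOver zero L = [] ∷ []
listsOver (suc k) L = cartesianProductWith _∷_ L (listsOver k L)

∈-listsOver : ∀ {A : Set} {L : List A} xs → All (_∈ L) xs → xs ∈ listsOver (length xs) L
∈-listsOver [] [] = here refl
∈-listsOver (x ∷ xs) (x∈L ∷ xs⊆L) = ∈-cartesianProductWith⁺ _∷_ x∈L (∈-listsOver xs xs⊆L)

candidates : ℕ → List (ℕ × ℕ)
candidates b = cartesianProduct (upTo (suc b)) (upTo (suc b))

∈-candidates : ∀ {n} {S : Vec Base n} {a b x} → BasePairIn S a b x → x ∈ candidates b
∈-candidates (_ , p<q , q≤b , _) = ∈-cartesianProduct⁺ (∈-upTo⁺ (s≤s (≤-trans (<⇒≤ p<q) q≤b))) (∈-upTo⁺ (s≤s q≤b))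

Achievable : ∀ {n} → Vec Base n → ℕ → ℕ → ℕ → Set
Achievable S a b k = Σ (List (ℕ × ℕ)) λ ps → ValidIn S a b ps × length ps ≡ k

achievable? : ∀ {n} (S : Vec Base n) a b → Decidable (Achievable S a b)
achievable? S a b k =
  map′ Any.satisfied enumerated
    (Any.any? (λ ps → valid? S a b ps ×-dec (length ps ≟ k)) (listsOver k (candidates b)))
  where
  enumerated : Achievable S a b k → Any.Any (λ ps → ValidIn S a b ps × length ps ≡ k) (listsOver k (candidates b))
  enumerated (ps , v , refl) = lose (∈-listsOver ps (All.map (∈-candidates {S = S}) (proj₁ v))) (v , refl)

largest : (P : ℕ → Set) → Decidable P → P 0 → ∀ B → (∀ k → P k → k ≤ B) →
  Σ ℕ λ m → P m × (∀ k → P k → k ≤ m)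
largest P P? P0 zero bounded = 0 , P0 , bounded
largest P P? P0 (suc B) bounded with P? (suc B)
... | yes PB = suc B , PB , bounded
... | no ¬PB = largest P P? P0 B λ k Pk → m<1+n⇒m≤n (≤∧≢⇒< (bounded k Pk) λ { refl → ¬PB Pk })

-- M[a,b] exists: sizes of valid sets in [a,b] are bounded by b + 1 (take k = b + 1 above).
M-exists : ∀ {n} (S : Vec Base n) a b → Σ ℕ (IsM S a b)
M-exists S a b with largest (Achievable S a b) (achievable? S a b) ([] , ([] , [] , λ ()) , refl) (suc b) bounded
  where
  bounded : ∀ k → Achievable S a b k → k ≤ suc b
  bounded k (ps , v , refl) = length-valid S (suc b) a b ps (≤-trans (n<1+n b) (m≤m+n (suc b) a)) v
... | m , achieved , maximal = m , achieved , λ ps v → maximal (length ps) (ps , v , refl)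

M : ∀ {n} → Vec Base n → ℕ → ℕ → ℕ
M S a b = proj₁ (M-exists S a b)

M-spec : ∀ {n} (S : Vec Base n) a b → IsM S a b (M S a b)
M-spec S a b = proj₂ (M-exists S a b)

IsM-unique : ∀ {n} (S : Vec Base n) {a b m m′} → IsM S a b m → IsM S a b m′ → m ≡ m′
IsM-unique S ((ps , v , refl) , max) ((ps′ , v′ , refl) , max′) = ≤-antisym (max′ ps v) (max ps′ v′)

Maximiser : (ℕ → ℕ) → ℕ → ℕ → ℕ → Set
Maximiser f t o l = t ≤ l × l ≤ o × (∀ l′ → t ≤ l′ → l′ ≤ o → f l′ ≤ f l)

maximiser : ∀ f t o → t ≤ o → ∃ (Maximiser f t o)
maximiser f t o t≤o = l , proj₁ l-inRange , proj₂ l-inRange , maximal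
  where
  range : List ℕ
  range = filter (t ≤?_) (upTo (suc o))

  l : ℕ
  l = argmax f t range

  InRange : ℕ → Set
  InRange l = t ≤ l × l ≤ o

  range-inRange : All InRange range
  range-inRange = All.tabulate λ {l} l∈ →
    let (l∈upTo , t≤l) = ∈-filter⁻ (t ≤?_) {xs = upTo (suc o)} l∈ in t≤l , ≤-pred (∈-upTo⁻ l∈upTo)

  l-inRange : InRange l
  l-inRange = argmax-all f {P = InRange} (≤-refl , t≤o) range-inRange

  maximal : ∀ l′ → t ≤ l′ → l′ ≤ o → f l′ ≤ f l
  maximal l′ t≤l′ l′≤o =
    All.lookup (f[xs]≤f[argmax] t range) (∈-filter⁺ (t ≤?_) (∈-upTo⁺ (s≤s l′≤o)) t≤l′)

max-sandwich : ∀ {f g t o l k} → Maximiser f t o l → Maximiser g t o k →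
  (∀ l′ → t ≤ l′ → l′ ≤ o → f l′ ≤ g l′ × g l′ ≤ suc (f l′)) → f l ≤ g k × g k ≤ suc (f l)
max-sandwich {f} {g} {l = l} {k} (t≤l , l≤o , f≤f[l]) (t≤k , k≤o , g≤g[k]) f≤g≤f+1 =
  ≤-trans (proj₁ (f≤g≤f+1 l t≤l l≤o)) (g≤g[k] l t≤l l≤o) ,
  ≤-trans (proj₂ (f≤g≤f+1 k t≤k k≤o)) (s≤s (f≤f[l] k t≤k k≤o))

split : ∀ {n} → Vec Base n → ℕ → ℕ → ℕ → ℕ
split S a j l = M S a l + M S (suc l) j

maximiser⇒IsP : ∀ {n} (S : Vec Base n) a j t o {l} → Maximiser (split S a j) t o l → IsP S a j t o (split S a j l)
maximiser⇒IsP S a j t o {l} (t≤l , l≤o , maximal) =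
  (l , t≤l , l≤o , M S a l , M S (suc l) j , M-spec S a l , M-spec S (suc l) j , refl) ,
  λ l′ m₁ m₂ t≤l′ l′≤o isM₁ isM₂ →
    subst (_≤ split S a j l)
      (cong₂ _+_ (IsM-unique S (M-spec S a l′) isM₁) (IsM-unique S (M-spec S (suc l′) j) isM₂))
      (maximal l′ t≤l′ l′≤o)

split-step : ∀ {n} (S : Vec Base n) a j l → split S (suc a) j l ≤ split S a j l × split S a j l ≤ suc (split S (suc a) j l)
split-step S a j l with IsM-step S a l (M-spec S (suc a) l) (M-spec S a l)
... | lower , upper = +-monoˡ-≤ (M S (suc l) j) lower , +-monoˡ-≤ (M S (suc l) j) upper

lemma4 : ∀ {n} (S : Vec Base n) (i j t o : ℕ) →
    2 ≤ i → i ≤ t → t ≤ o → o < j → j ≤ n →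
    Σ ℕ λ x → Σ ℕ λ y →
    IsP S i j t o x × IsP S (i ∸ 1) j t o y × x ≤ y × y ≤ suc x
lemma4 S (suc a) j t o _ _ t≤o _ _ =
  split S (suc a) j l , split S a j k ,
  maximiser⇒IsP S (suc a) j t o max-l , maximiser⇒IsP S a j t o max-k ,
  max-sandwich max-l max-k (λ l′ _ _ → split-step S a j l′)
  where
  l k : ℕ
  l = proj₁ (maximiser (split S (suc a) j) t o t≤o)
  k = proj₁ (maximiser (split S a j) t o t≤o)

  max-l : Maximiser (split S (suc a) j) t o l
  max-l = proj₂ (maximiser (split S (suc a) j) t o t≤o)

  max-k : Maximiser (split S a j) t o k
  max-k = proj₂ (maximiser (split S a j) t o t≤o)
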